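{- Let $A$ be a finite alphabet with $|A|\ge 2$, let $L\subseteq A^*$ and $k\geq 1$. Then 1. $L\in\mathcal{L}_{1/2}(k)$ if and only if $L$ is regular and $m^+(L)<k$; 2. $L\in\mathrm{co}\mathcal{L}_{1/2}(k)$ if and only if $L$ is regular and $m^-(L)<k$.
   Context: $\mathcal{L}_{1/2}$ is the class of finite unions of languages $A^*a_1A^*a_2A^*\cdots A^*a_nA^*$ ($n\geq 0$, $a_i\in A$). For $k\geq1$, $\mathcal{L}_{1/2}(k)=\{L_1\triangle L_2\triangle\cdots\triangle L_k: L_1,\dots,L_k\in\mathcal{L}_{1/2}\}$ ($\triangle$ = symmetric difference), and $\mathrm{co}\mathcal{L}_{1/2}(k)=\{A^*\setminus L: L\in\mathcal{L}_{1/2}(k)\}$. Subword relation: $w\sqsubseteq v$ iff there are $n\geq 0$, $a_1,\dots,a_n\in A$, $v_0,\dots,v_n\in A^*$ with $w=a_1\cdots a_n$ and $v=v_0a_1v_1\cdots a_nv_n$. For $m\geq 0$, $w\to^m_L v$ iff there exist $w_0,\dots,w_m$ with $w=w_0\sqsubseteq w_1\sqsubseteq\cdots\sqsubseteq w_m\sqsubseteq v$ and ($w_i\in L\iff w_{i+1}\notin L$) for $0\leq i\leq m-1$. $L^+(m)=\{v:\exists w\in L,\ w\to^m_L v\}$, $L^-(m)=\{v:\exists w\notin L,\ w\to^m_L v\}$. $m^+(L)=\max\{m: L^+(m)\neq\emptyset\}$, $m^-(L)=\max\{m:L^-(m)\neq\emptyset\}$ (possibly $\infty$; the maximum of the empty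 set is taken as $-1$). -}

module Defs where

open import Data.Nat using (ℕ; zero; suc; _<_)
open import Data.Fin using (Fin)
open import Data.Bool using (Bool; true)
open import Data.List using (List; []; _∷_; _++_; foldl)
open import Data.Vec using (Vec; []; _∷_)
open import Data.Vec.Relation.Unary.All using (All)
open import Data.List.Relation.Unary.Any using (Any)
open import Data.List.Relation.Binary.Sublist.Propositional using (_⊆_)
open import Data.Product using (Σ; ∃; ∃-syntax; _×_; _,_)
open import Data.Sum using (_⊎_)
open import Data.Empty using (⊥)
open import Data.Unit using (⊤)
open import Relation.Nullary using (¬_)
open import Relation.Binary.PropositionalEquality using (_≡_)
open import Function.Bundles using (_⇔_)
open import Level using (Level) renaming (suc to lsuc; zero to lzero)

Language : Set → Set₁
Language A = List A → Set

module _ {A : Set} where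

  _≐_ : Language A → Language A → Set
  L ≐ M = ∀ w → (L w ⇔ M w)

  ∅ : Language A
  ∅ _ = ⊥

  A* : Language A
  A* _ = ⊤

  ⟦_⟧ : A → Language A
  ⟦ a ⟧ w = w ≡ a ∷ []

  _·_ : Language A → Language A → Language A
  (L · M) w = ∃[ x ] ∃[ y ] (w ≡ x ++ y × L x × M y)

  _△_ : Language A → Language A → Language A
  (L △ M) w = (L w × ¬ M w) ⊎ (¬ L w × M w)

  _⊑_ : List A → List A → Set
  w ⊑ v = w ⊆ v

  Pattern : List A → Language A
  Pattern []      = A*
  Pattern (a ∷ u) = A* · (⟦ a ⟧ · Pattern u)

  UnionPatterns : List (List A) → Language A
  UnionPatterns ps w = Any (λ u → Pattern u w) ps

  InL½ : Language A → Set
  InL½ L = ∃[ ps ] (L ≐ UnionPatterns ps)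

  △-fold : ∀ {k} → Vec (Language A) k → Language A
  △-fold []       = ∅
  △-fold (L ∷ Ls) = L △ △-fold Ls

  InL½[_] : ℕ → Language A → Set₁
  InL½[ k ] L = Σ (Vec (Language A) k) λ Ls → All InL½ Ls × (L ≐ △-fold Ls)

  InCoL½[_] : ℕ → Language A → Set₁
  InCoL½[ k ] L = ∃[ M ] (InL½[ k ] M × (∀ w → (L w ⇔ (¬ M w))))

  record DFA : Set where
    field
      states : ℕ
      δ      : Fin states → A → Fin states
      q₀     : Fin states
      final  : Fin states → Bool

    run : Fin states → List A → Fin states
    run q w = foldl δ q w

    Accepts : Language A
    Accepts w = final (run q₀ w) ≡ true

  Regular : Language A → Set
  Regular L = ∃[ M ] (L ≐ DFA.Accepts M)

  Arrow : Language A → ℕ → List A → List A → Set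
  Arrow L zero    w v = w ⊑ v
  Arrow L (suc m) w v = ∃[ w₁ ] (w ⊑ w₁ × (L w ⇔ (¬ L w₁)) × Arrow L m w₁ v)

  Lplus : Language A → ℕ → Language A
  Lplus L m v = ∃[ w ] (L w × Arrow L m w v)

  Lminus : Language A → ℕ → Language A
  Lminus L m v = ∃[ w ] (¬ L w × Arrow L m w v)

  -- m⁺(L) < k, with m⁺(L) = max{m : L⁺(m) ≠ ∅} ∈ {-1} ∪ ℕ ∪ {∞}:
  -- every m with L⁺(m) nonempty satisfies m < k.
  m⁺_<_ : Language A → ℕ → Set
  m⁺ L < k = ∀ m v → Lplus L m v → m < k

  m⁻_<_ : Language A → ℕ → Set
  m⁻ L < k = ∀ m v → Lminus L m v → m < k

-- (⇒) Write L = L₁ △ ⋯ △ Lₖ with upward closed Lᵢ and count the Lᵢ containing a word.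
-- The count is monotone along ⊑, and if it stays constant from w to w′ ⊒ w then every Lᵢ,
-- hence L, agrees on w and w′. So it strictly increases along an alternating chain, which
-- therefore has length < k when it starts in L (count ≥ 1). Regularity comes from the
-- subword automata recognising A*a₁A*⋯aₙA*.
-- (⇐) For regular L with m⁺(L) < k, L = L⁺(0) △ ⋯ △ L⁺(k−1), since the L⁺(j) decrease and
-- a word of L⁺(j) outside L⁺(j+1) lies in L exactly when j is even. Each L⁺(j) is upward
-- closed, so it lies in 𝓛½ once its minimal words are bounded in length: a chain witnessing
-- v ∈ L⁺(j) is coded by one tagged word, and pumping it down in the product of j+1 copies of
-- an automaton for L shortens all links of the chain at once without changing their
-- membership in L.
-- The co-class statement follows by complementation, as L⁻(m) = (A* ∖ L)⁺(m).

module Submission where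

open import Defs
open import Data.Bool as Bool using (Bool; true; false; not; _∧_; _∨_; if_then_else_)
open import Data.Bool.Properties using (not-¬; ¬-not; not-involutive; T-≡)
open import Data.Empty using (⊥-elim)
open import Data.Fin as Fin using (Fin; toℕ; combine; remQuot)
open import Data.Fin.Properties using (pigeonhole; toℕ<n; remQuot-combine; combine-injective)
open import Data.List using (List; []; _∷_; _++_; map; filter; take; drop; length; cartesianProductWith; allFin)
open import Data.List.Membership.Propositional using (_∈_; find; lose)
open import Data.List.Membership.Propositional.Properties
  using (∈-filter⁺; ∈-filter⁻; ∈-cartesianProductWith⁺; ∈-allFin)
open import Data.List.Properties using (foldl-++; take++drop≡id; length-map; length-filter)
open import Data.List.Relation.Binary.Sublist.Propositional using ([]; _∷_; _∷ʳ_; ⊆-refl; ⊆-trans)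
open import Data.List.Relation.Binary.Sublist.Propositional.Properties
  using ([]⊆-universal; ∷⁻; ∷ʳ⁻; ++⁺ˡ; ++⁺; take⁺; drop-⊆; length-mono-≤; filter⁺; map⁺)
open import Data.List.Relation.Unary.Any as Any using (here; there)
open import Data.Nat using (ℕ; zero; suc; _≤_; _<_; _+_; _*_; z≤n; s≤s; _≤?_; _<?_)
open import Data.Nat.Properties
open import Data.Product using (∃-syntax; _×_; _,_; proj₁; proj₂)
open import Data.Product.Function.NonDependent.Propositional using (_×-⇔_)
open import Data.Sum using (_⊎_; inj₁; inj₂; [_,_]′)
open import Data.Sum.Function.Propositional using (_⊎-⇔_)
open import Data.Unit using (⊤; tt)
open import Data.Vec using (Vec; []; _∷_)
open import Data.Vec.Relation.Unary.All as All using (All; []; _∷_)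
open import Function using (_∘_)
open import Function.Bundles using (_⇔_; mk⇔; Equivalence)
open import Function.Construct.Composition using (_⇔-∘_)
open import Function.Construct.Identity using (⇔-id)
open import Function.Construct.Symmetry using (⇔-sym)
open import Function.Related.TypeIsomorphisms using (¬-cong-⇔)
open import Relation.Binary.Definitions using (DecidableEquality)
open import Relation.Binary.PropositionalEquality
open import Relation.Nullary using (¬_; Dec; yes; no; does; proof; _because_; contradiction)
open import Relation.Nullary.Decidable using (map′; _×-dec_; _→-dec_; ¬?; decidable-stable)
open import Relation.Nullary.Reflects
  using (Reflects; ofʸ; ofⁿ; fromEquivalence; ¬-reflects; _×-reflects_; _⊎-reflects_)
open import Relation.Unary using (∁; Decidable)
open Equivalence

Reflects⇒⇔≡true : ∀ {P : Set} {b} → Reflects P b → P ⇔ (b ≡ true)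
Reflects⇒⇔≡true (ofʸ p)  = mk⇔ (λ _ → refl) (λ _ → p)
Reflects⇒⇔≡true (ofⁿ ¬p) = mk⇔ (⊥-elim ∘ ¬p) (λ ())

Reflects-resp-⇔ : ∀ {P Q : Set} {b} → P ⇔ Q → Reflects P b → Reflects Q b
Reflects-resp-⇔ P⇔Q (ofʸ p)  = ofʸ (to P⇔Q p)
Reflects-resp-⇔ P⇔Q (ofⁿ ¬p) = ofⁿ (¬p ∘ from P⇔Q)

⇔⇒¬⇔¬ : ∀ {P Q : Set} → P ⇔ Q → ¬ (P ⇔ (¬ Q))
⇔⇒¬⇔¬ {P} {Q} P⇔Q P⇔¬Q = ¬q (to P⇔Q (from P⇔¬Q ¬q))
  where
  ¬p : ¬ P
  ¬p p = to P⇔¬Q p (to P⇔Q p)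
  ¬q : ¬ Q
  ¬q q = ¬p (from P⇔Q q)

△-cong : ∀ {P P′ Q Q′ : Set} → P ⇔ P′ → Q ⇔ Q′ →
         ((P × ¬ Q) ⊎ (¬ P × Q)) ⇔ ((P′ × ¬ Q′) ⊎ (¬ P′ × Q′))
△-cong P⇔ Q⇔ = (P⇔ ×-⇔ ¬-cong-⇔ Q⇔) ⊎-⇔ (¬-cong-⇔ P⇔ ×-⇔ Q⇔)

-- Subwords and upward closed languages

module _ {A : Set} where

  ≐-sym : {L M : Language A} → L ≐ M → M ≐ L
  ≐-sym L≐M w = ⇔-sym (L≐M w)

  UpwardClosed : Language A → Set
  UpwardClosed L = ∀ {w v} → w ⊑ v → L w → L v

  Pattern⇒⊑ : ∀ (u : List A) {w} → Pattern u w → u ⊑ w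
  Pattern⇒⊑ []      {w} _ = []⊆-universal w
  Pattern⇒⊑ (a ∷ u) (x , _ , refl , _ , _ , _ , refl , refl , p) = ++⁺ˡ x (refl ∷ Pattern⇒⊑ u p)

  ⊑⇒Pattern : ∀ {u w : List A} → u ⊑ w → Pattern u w
  ⊑⇒Pattern {[]}    _ = tt
  ⊑⇒Pattern {_ ∷ _} (b ∷ʳ p) with ⊑⇒Pattern p
  ... | x , y , refl , _ , q = b ∷ x , y , refl , tt , q
  ⊑⇒Pattern {_ ∷ _} (refl ∷ p) = [] , _ , refl , tt , _ , _ , refl , refl , ⊑⇒Pattern p

  InL½⇒UpwardClosed : ∀ {L : Language A} → InL½ L → UpwardClosed L
  InL½⇒UpwardClosed (_ , L≐) w⊑v w∈L =
    from (L≐ _) (Any.map (λ {u} p → ⊑⇒Pattern (⊆-trans (Pattern⇒⊑ u p) w⊑v)) (to (L≐ _) w∈L))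

  ∃-⊑? : {P : List A → Set} → Decidable P → ∀ v → Dec (∃[ u ] (u ⊑ v × P u))
  ∃-⊑? P? [] with P? []
  ... | yes p = yes ([] , [] , p)
  ... | no ¬p = no λ { (_ , [] , p) → ¬p p }
  ∃-⊑? P? (a ∷ v) with ∃-⊑? P? v | ∃-⊑? (P? ∘ (a ∷_)) v
  ... | yes (u , u⊑v , p) | _                   = yes (u , a ∷ʳ u⊑v , p)
  ... | no _              | yes (u , u⊑v , p)   = yes (a ∷ u , refl ∷ u⊑v , p)
  ... | no skipping-a     | no using-a          =
    no λ { (u , _ ∷ʳ u⊑v , p) → skipping-a (u , u⊑v , p)
         ; (_ , refl ∷ u⊑v , p) → using-a (_ , u⊑v , p) }

  wordsUpTo : List A → ℕ → List (List A)
  wordsUpTo letters zero    = [] ∷ []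
  wordsUpTo letters (suc b) = [] ∷ cartesianProductWith _∷_ letters (wordsUpTo letters b)

  ∈-wordsUpTo : ∀ {letters} → (∀ a → a ∈ letters) → ∀ b u → length u ≤ b → u ∈ wordsUpTo letters b
  ∈-wordsUpTo complete zero    []      _           = here refl
  ∈-wordsUpTo complete (suc b) []      _           = here refl
  ∈-wordsUpTo complete (suc b) (a ∷ u) (s≤s |u|≤b) =
    there (∈-cartesianProductWith⁺ _∷_ (complete a) (∈-wordsUpTo complete b u |u|≤b))

  HasBoundedBasis : Language A → Set
  HasBoundedBasis K = ∃[ B ] (∀ {v} → K v → ∃[ u ] (u ⊑ v × length u ≤ B × K u))

  HasBoundedBasis⇒InL½ : (letters : List A) → (∀ a → a ∈ letters) →
                         ∀ {K : Language A} → UpwardClosed K → Decidable K → HasBoundedBasis K → InL½ K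
  HasBoundedBasis⇒InL½ letters complete {K} up K? (B , basis) = basis-words , λ _ → mk⇔ generated-by generates
    where
    basis-words : List (List A)
    basis-words = filter K? (wordsUpTo letters B)
    generated-by : ∀ {v} → K v → UnionPatterns basis-words v
    generated-by v∈K = let u , u⊑v , short , u∈K = basis v∈K in
      lose (∈-filter⁺ K? (∈-wordsUpTo complete B u short) u∈K) (⊑⇒Pattern u⊑v)
    generates : ∀ {v} → UnionPatterns basis-words v → K v
    generates p = let u , u∈basis , u⊑v = find p in
      up (Pattern⇒⊑ u u⊑v) (proj₂ (∈-filter⁻ K? {xs = wordsUpTo letters B} u∈basis))

-- Automata

module _ {A : Set} where
  open DFA

  accepts : DFA {A} → List A → Bool
  accepts D w = final D (run D (q₀ D) w)

  _Recognises_ : DFA {A} → Language A → Set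
  D Recognises L = ∀ w → Reflects (L w) (accepts D w)

  Recognises⇒Regular : ∀ {D} {L : Language A} → D Recognises L → Regular L
  Recognises⇒Regular {D} r = D , Reflects⇒⇔≡true ∘ r

  Regular⇒Recognised : ∀ {L : Language A} → Regular L → ∃[ D ] (D Recognises L)
  Regular⇒Recognised (D , L≐) = D , λ w →
    fromEquivalence (from (L≐ w) ∘ to T-≡) (from T-≡ ∘ to (L≐ w))

  Regular⇒Decidable : ∀ {L : Language A} → Regular L → Decidable L
  Regular⇒Decidable R w = let D , r = Regular⇒Recognised R in accepts D w because r w

  Regular-resp-≐ : ∀ {L M : Language A} → L ≐ M → Regular L → Regular M
  Regular-resp-≐ L≐M (D , L≐D) = D , λ w → L≐D w ⇔-∘ ⇔-sym (L≐M w)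

  Regular-run-≡⇒⇔ : ∀ {L : Language A} (R : Regular L) → let D = proj₁ R in
                    ∀ {u u′} → run D (q₀ D) u ≡ run D (q₀ D) u′ → L u ⇔ L u′
  Regular-run-≡⇒⇔ {L} (D , L≐) {u} {u′} same =
    ⇔-sym (L≐ u′) ⇔-∘ subst (λ q → L u ⇔ (final D q ≡ true)) same (L≐ u)

  constant : Bool → DFA {A}
  constant b = record { states = 1 ; δ = λ q _ → q ; q₀ = Fin.zero ; final = λ _ → b }

  Regular-∅ : Regular (∅ {A})
  Regular-∅ = Recognises⇒Regular {constant false} (λ _ → ofⁿ (λ ()))

  Regular-∁ : ∀ {L : Language A} → Regular L → Regular (∁ L)
  Regular-∁ R = let D , r = Regular⇒Recognised R in
    Recognises⇒Regular {record D { final = not ∘ final D }} (¬-reflects ∘ r)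

  Regular⇔Regular-∁ : ∀ {L : Language A} → Decidable L → Regular L ⇔ Regular (∁ L)
  Regular⇔Regular-∁ {L} L? = mk⇔ Regular-∁ (Regular-resp-≐ ∁∁L≐L ∘ Regular-∁)
    where
    ∁∁L≐L : ∁ (∁ L) ≐ L
    ∁∁L≐L w = mk⇔ (decidable-stable (L? w)) (λ Lw ¬Lw → ¬Lw Lw)

  product : (Bool → Bool → Bool) → DFA {A} → DFA {A} → DFA {A}
  product f D E = record
    { states = states D * states E
    ; δ      = λ s a → let p , q = remQuot (states E) s in combine (δ D p a) (δ E q a)
    ; q₀     = combine (q₀ D) (q₀ E)
    ; final  = λ s → let p , q = remQuot (states E) s in f (final D p) (final E q)
    }

  run-product : ∀ f D E p q w → run (product f D E) (combine p q) w ≡ combine (run D p w) (run E q w)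
  run-product f D E p q []      = refl
  run-product f D E p q (a ∷ w) = begin
    run (product f D E) (combine p q) (a ∷ w)
      ≡⟨ cong (λ (p′ , q′) → run (product f D E) (combine (δ D p′ a) (δ E q′ a)) w)
              (remQuot-combine p q) ⟩
    run (product f D E) (combine (δ D p a) (δ E q a)) w
      ≡⟨ run-product f D E (δ D p a) (δ E q a) w ⟩
    combine (run D p (a ∷ w)) (run E q (a ∷ w)) ∎
    where open ≡-Reasoning

  accepts-product : ∀ f D E w → accepts (product f D E) w ≡ f (accepts D w) (accepts E w)
  accepts-product f D E w = begin
    accepts (product f D E) w
      ≡⟨ cong (final (product f D E)) (run-product f D E (q₀ D) (q₀ E) w) ⟩
    final (product f D E) (combine (run D (q₀ D) w) (run E (q₀ E) w))
      ≡⟨ cong (λ (p , q) → f (final D p) (final E q)) (remQuot-combine (run D (q₀ D) w) (run E (q₀ E) w)) ⟩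
    f (accepts D w) (accepts E w) ∎
    where open ≡-Reasoning

  Regular-combine : ∀ f {L M N : Language A} → Regular L → Regular M →
                    (∀ {w b c} → Reflects (L w) b → Reflects (M w) c → Reflects (N w) (f b c)) → Regular N
  Regular-combine f RL RM combine-reflects =
    let D , r = Regular⇒Recognised RL ; E , s = Regular⇒Recognised RM in
    Recognises⇒Regular {product f D E}
      λ w → subst (Reflects _) (sym (accepts-product f D E w)) (combine-reflects (r w) (s w))

  Regular-∪ : ∀ {L M : Language A} → Regular L → Regular M → Regular (λ w → L w ⊎ M w)
  Regular-∪ RL RM = Regular-combine _∨_ RL RM _⊎-reflects_

  Regular-△ : ∀ {L M : Language A} → Regular L → Regular M → Regular (L △ M)
  Regular-△ RL RM = Regular-combine (λ b c → (b ∧ not c) ∨ (not b ∧ c)) RL RM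
    λ r s → (r ×-reflects ¬-reflects s) ⊎-reflects (¬-reflects r ×-reflects s)

  Regular-△-fold : ∀ {k} {Ls : Vec (Language A) k} → All Regular Ls → Regular (△-fold Ls)
  Regular-△-fold []       = Regular-∅
  Regular-△-fold (R ∷ Rs) = Regular-△ R (Regular-△-fold Rs)

module _ {A : Set} (_≟_ : DecidableEquality A) where
  open DFA

  after : A → DFA {A} → DFA {A}
  after a D = record
    { states = suc (states D)
    ; δ      = step
    ; q₀     = Fin.zero
    ; final  = λ { Fin.zero → false ; (Fin.suc q) → final D q }
    }
    where
    step : Fin (suc (states D)) → A → Fin (suc (states D))
    step Fin.zero    b with b ≟ a
    ... | yes _ = Fin.suc (q₀ D)
    ... | no _  = Fin.zero
    step (Fin.suc q) b = Fin.suc (δ D q b)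

  run-after : ∀ a D q w → run (after a D) (Fin.suc q) w ≡ Fin.suc (run D q w)
  run-after a D q []      = refl
  run-after a D q (b ∷ w) = run-after a D (δ D q b) w

  subwordDFA : List A → DFA {A}
  subwordDFA []      = constant true
  subwordDFA (a ∷ u) = after a (subwordDFA u)

  subwordDFA-Recognises : ∀ u → subwordDFA u Recognises (u ⊑_)
  subwordDFA-Recognises []      w = ofʸ ([]⊆-universal w)
  subwordDFA-Recognises (a ∷ u) = waiting
    where
    D = subwordDFA (a ∷ u)
    waiting : ∀ w → Reflects ((a ∷ u) ⊑ w) (final D (run D Fin.zero w))
    waiting []      = ofⁿ (λ ())
    waiting (b ∷ w) with b ≟ a
    ... | yes refl rewrite run-after a (subwordDFA u) (q₀ (subwordDFA u)) w =
      Reflects-resp-⇔ (mk⇔ (refl ∷_) ∷⁻) (subwordDFA-Recognises u w)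
    ... | no b≢a = Reflects-resp-⇔ (mk⇔ (b ∷ʳ_) (∷ʳ⁻ (b≢a ∘ sym))) (waiting w)

  InL½⇒Regular : ∀ {L : Language A} → InL½ L → Regular L
  InL½⇒Regular (ps , L≐) = Regular-resp-≐ (≐-sym L≐) (Regular-UnionPatterns ps)
    where
    Regular-Pattern : ∀ u → Regular (Pattern u)
    Regular-Pattern u = Regular-resp-≐ (λ w → mk⇔ ⊑⇒Pattern (Pattern⇒⊑ u))
                                       (Recognises⇒Regular {D = subwordDFA u} (subwordDFA-Recognises u))
    Regular-UnionPatterns : ∀ ps → Regular (UnionPatterns ps)
    Regular-UnionPatterns []       = Regular-resp-≐ (λ _ → mk⇔ (λ ()) (λ ())) Regular-∅
    Regular-UnionPatterns (u ∷ ps) =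
      Regular-resp-≐ (λ _ → mk⇔ [ here , there ]′ λ { (here p) → inj₁ p ; (there p) → inj₂ p })
                     (Regular-∪ (Regular-Pattern u) (Regular-UnionPatterns ps))

  InL½[k]⇒Regular : ∀ {k} {L : Language A} → InL½[ k ] L → Regular L
  InL½[k]⇒Regular (_ , Ls∈ , L≐) =
    Regular-resp-≐ (≐-sym L≐) (Regular-△-fold (All.map InL½⇒Regular Ls∈))

  InL½⇒Decidable : ∀ {L : Language A} → InL½ L → Decidable L
  InL½⇒Decidable = Regular⇒Decidable ∘ InL½⇒Regular

-- Pumping down

take++drop-⊑ : ∀ {B : Set} {i j} (x : List B) → i ≤ j → (take i x ++ drop j x) ⊑ x
take++drop-⊑ {i = i} {j} x i≤j =
  subst ((take i x ++ drop j x) ⊑_) (take++drop≡id j x) (++⁺ (take⁺ i≤j) ⊆-refl)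

take++drop-shorter : ∀ {B : Set} {i j} (x : List B) → i < j → j ≤ length x →
                     length (take i x ++ drop j x) < length x
take++drop-shorter {i = zero}  {suc j} (a ∷ x) _         _           = s≤s (length-mono-≤ (drop-⊆ j x))
take++drop-shorter {i = suc i} {suc j} (a ∷ x) (s≤s i<j) (s≤s j≤|x|) = s≤s (take++drop-shorter x i<j j≤|x|)

module _ {B : Set} (D : DFA {B}) where
  open DFA D

  run-take++drop : ∀ q x {i j} → run q (take i x) ≡ run q (take j x) → run q (take i x ++ drop j x) ≡ run q x
  run-take++drop q x {i} {j} same = begin
    run q (take i x ++ drop j x)        ≡⟨ foldl-++ δ q (take i x) (drop j x) ⟩
    run (run q (take i x)) (drop j x)   ≡⟨ cong (λ q′ → run q′ (drop j x)) same ⟩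
    run (run q (take j x)) (drop j x)   ≡⟨ foldl-++ δ q (take j x) (drop j x) ⟨
    run q (take j x ++ drop j x)        ≡⟨ cong (run q) (take++drop≡id j x) ⟩
    run q x                             ∎
    where open ≡-Reasoning

  loop-removal : ∀ q x → states ≤ length x →
                 ∃[ x′ ] (x′ ⊑ x × length x′ < length x × run q x′ ≡ run q x)
  loop-removal q x N≤|x| with pigeonhole (s≤s N≤|x|) (λ i → run q (take (toℕ i) x))
  ... | i , j , i<j , same =
    take (toℕ i) x ++ drop (toℕ j) x ,
    take++drop-⊑ x (<⇒≤ i<j) ,
    take++drop-shorter x i<j (≤-pred (toℕ<n j)) ,
    run-take++drop q x {toℕ i} {toℕ j} same

  pump-down : ∀ q x → ∃[ x′ ] (x′ ⊑ x × length x′ < states × run q x′ ≡ run q x)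
  pump-down q []      = [] , [] , ≤-trans (s≤s z≤n) (toℕ<n q) , refl
  pump-down q (a ∷ x) with pump-down (δ q a) x
  ... | x′ , x′⊑x , short , same with suc (length x′) <? states
  ...   | yes shorter = a ∷ x′ , refl ∷ x′⊑x , shorter , same
  ...   | no ¬shorter with loop-removal q (a ∷ x′) (≮⇒≥ ¬shorter)
  ...     | y , y⊑ax′ , y-shorter , same′ =
    y , ⊆-trans y⊑ax′ (refl ∷ x′⊑x) , ≤-trans y-shorter short , trans same′ same

-- Alternating chains

notⁿ : ℕ → Bool → Bool
notⁿ zero    b = b
notⁿ (suc j) b = notⁿ j (not b)

notⁿ-suc : ∀ j b → notⁿ (suc j) b ≡ not (notⁿ j b)
notⁿ-suc zero    b = refl
notⁿ-suc (suc j) b = notⁿ-suc j (not b)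

module _ {A : Set} {L : Language A} where

  Arrow⇒⊑ : ∀ m {w v} → Arrow L m w v → w ⊑ v
  Arrow⇒⊑ zero    w⊑v                = w⊑v
  Arrow⇒⊑ (suc m) (_ , w⊑w₁ , _ , r) = ⊆-trans w⊑w₁ (Arrow⇒⊑ m r)

  Arrow-resp-⊑ : ∀ m {w v v′} → Arrow L m w v → v ⊑ v′ → Arrow L m w v′
  Arrow-resp-⊑ zero    w⊑v                   v⊑v′ = ⊆-trans w⊑v v⊑v′
  Arrow-resp-⊑ (suc m) (w₁ , w⊑w₁ , alt , r) v⊑v′ = w₁ , w⊑w₁ , alt , Arrow-resp-⊑ m r v⊑v′

  Arrow-suc⇒Arrow : ∀ m {w v} → Arrow L (suc m) w v → Arrow L m w v
  Arrow-suc⇒Arrow zero    (_ , w⊑w₁ , _ , w₁⊑v)   = ⊆-trans w⊑w₁ w₁⊑v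
  Arrow-suc⇒Arrow (suc m) (w₁ , w⊑w₁ , alt , r) = w₁ , w⊑w₁ , alt , Arrow-suc⇒Arrow m r

  Lplus-UpwardClosed : ∀ m → UpwardClosed (Lplus L m)
  Lplus-UpwardClosed m v⊑v′ (w , w∈L , r) = w , w∈L , Arrow-resp-⊑ m r v⊑v′

  Lplus-suc⇒Lplus : ∀ m {v} → Lplus L (suc m) v → Lplus L m v
  Lplus-suc⇒Lplus m (w , w∈L , r) = w , w∈L , Arrow-suc⇒Arrow m r

module _ {A : Set} where

  Arrow-map : {L M : Language A} → (∀ {w w′} → (L w ⇔ (¬ L w′)) → (M w ⇔ (¬ M w′))) →
              ∀ m {w v} → Arrow L m w v → Arrow M m w v
  Arrow-map f zero    w⊑v                   = w⊑v
  Arrow-map f (suc m) (w₁ , w⊑w₁ , alt , r) = w₁ , w⊑w₁ , f alt , Arrow-map f m r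

  Lminus⇒Lplus-∁ : ∀ {L : Language A} m {v} → Lminus L m v → Lplus (∁ L) m v
  Lminus⇒Lplus-∁ m (w , w∉L , r) = w , w∉L , Arrow-map alternation-∁ m r
    where
    alternation-∁ : ∀ {P Q : Set} → (P ⇔ (¬ Q)) → ((¬ P) ⇔ (¬ ¬ Q))
    alternation-∁ alt = mk⇔ (λ ¬p ¬q → ¬p (from alt ¬q)) (λ ¬¬q p → ¬¬q (to alt p))

  Lplus-∁⇒Lminus : ∀ {L : Language A} → Decidable L → ∀ m {v} → Lplus (∁ L) m v → Lminus L m v
  Lplus-∁⇒Lminus L? m (w , w∉L , r) = w , w∉L , Arrow-map (alternation-∁⁻ (L? _)) m r
    where
    alternation-∁⁻ : ∀ {P Q : Set} → Dec P → ((¬ P) ⇔ (¬ ¬ Q)) → (P ⇔ (¬ Q))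
    alternation-∁⁻ P? alt = mk⇔ (λ p q → from alt (λ ¬q → ¬q q) p)
                                (λ ¬q → decidable-stable P? (λ ¬p → to alt ¬p ¬q))

  m⁻<⇔m⁺∁< : ∀ {L : Language A} {k} → Decidable L → m⁻ L < k ⇔ m⁺ (∁ L) < k
  m⁻<⇔m⁺∁< L? = mk⇔ (λ bound m v p → bound m v (Lplus-∁⇒Lminus L? m p))
                    (λ bound m v p → bound m v (Lminus⇒Lplus-∁ m p))

  Lplus-from : Language A → ℕ → (r : ℕ) → Vec (Language A) r
  Lplus-from L j zero    = []
  Lplus-from L j (suc r) = Lplus L j ∷ Lplus-from L (suc j) r

module _ {A : Set} (_≟_ : DecidableEquality A) {L : Language A} (L? : Decidable L) where
  open import Data.List.Relation.Binary.Sublist.DecPropositional _≟_ using (_⊆?_)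

  alternates? : ∀ w w′ → Dec (L w ⇔ (¬ L w′))
  alternates? w w′ = map′ (λ (f , g) → mk⇔ f g) (λ e → to e , from e)
                          ((L? w →-dec ¬? (L? w′)) ×-dec (¬? (L? w′) →-dec L? w))

  Arrow? : ∀ m w v → Dec (Arrow L m w v)
  Arrow? zero    w v = w ⊆? v
  Arrow? (suc m) w v = map′ (λ (w₁ , _ , step) → w₁ , step)
                            (λ (w₁ , step@(_ , _ , r)) → w₁ , Arrow⇒⊑ m r , step)
                            (∃-⊑? (λ w₁ → w ⊆? w₁ ×-dec alternates? w w₁ ×-dec Arrow? m w₁ v) v)

  Lplus? : ∀ m → Decidable (Lplus L m)
  Lplus? m v = map′ (λ (w , _ , p) → w , p) (λ (w , p@(_ , r)) → w , Arrow⇒⊑ m r , p)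
                    (∃-⊑? (λ w → L? w ×-dec Arrow? m w v) v)

  private
    χ : List A → Bool
    χ w = does (L? w)

    ∈⇔χ≡true : ∀ {w} → L w ⇔ (χ w ≡ true)
    ∈⇔χ≡true {w} = Reflects⇒⇔≡true (proof (L? w))

  alternates⇔ : ∀ {w w′} → (L w ⇔ (¬ L w′)) ⇔ (χ w′ ≡ not (χ w))
  alternates⇔ {w} {w′} with L? w | L? w′
  ... | yes p  | yes q  = mk⇔ (λ alt → contradiction q (to alt p)) (λ ())
  ... | yes p  | no ¬q  = mk⇔ (λ _ → refl) (λ _ → mk⇔ (λ _ → ¬q) (λ _ → p))
  ... | no ¬p  | yes q  = mk⇔ (λ _ → refl) (λ _ → mk⇔ (⊥-elim ∘ ¬p) (λ ¬q → contradiction q ¬q))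
  ... | no ¬p  | no ¬q  = mk⇔ (λ alt → contradiction (from alt ¬q) ¬p) (λ ())

  Arrow-parity-or-extends : ∀ j {w v} → Arrow L j w v → χ v ≡ notⁿ j (χ w) ⊎ Arrow L (suc j) w v
  Arrow-parity-or-extends zero {w} {v} w⊑v with χ v Bool.≟ χ w
  ... | yes same  = inj₁ same
  ... | no differ = inj₂ (v , w⊑v , from alternates⇔ (¬-not differ) , ⊆-refl)
  Arrow-parity-or-extends (suc j) (w₁ , w⊑w₁ , alt , r) with Arrow-parity-or-extends j r
  ... | inj₁ parity = inj₁ (trans parity (cong (notⁿ j) (to alternates⇔ alt)))
  ... | inj₂ r′     = inj₂ (w₁ , w⊑w₁ , alt , r′)

  Lplus-top-parity : ∀ j {v} → Lplus L j v → ¬ Lplus L (suc j) v → χ v ≡ notⁿ j true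
  Lplus-top-parity j (w , w∈L , r) ∉Lplus with Arrow-parity-or-extends j r
  ... | inj₁ parity = trans parity (cong (notⁿ j) (to ∈⇔χ≡true w∈L))
  ... | inj₂ r′     = contradiction (w , w∈L , r′) ∉Lplus

  module _ {k} (bounded : m⁺ L < k) where

    △-fold-Lplus-from : ∀ j r → k ≤ j + r → ∀ v →
                        △-fold (Lplus-from L j r) v ⇔ (Lplus L j v × χ v ≡ notⁿ j true)
    △-fold-Lplus-from j zero k≤j+0 v =
      mk⇔ (λ ()) (λ (p , _) → ≤⇒≯ (subst (k ≤_) (+-identityʳ j) k≤j+0) (bounded j v p))
    △-fold-Lplus-from j (suc r) k≤j+r+1 v = mk⇔ forward backward
      where
      tail = △-fold-Lplus-from (suc j) r (subst (k ≤_) (+-suc j r) k≤j+r+1) v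
      flips : notⁿ (suc j) true ≡ not (notⁿ j true)
      flips = notⁿ-suc j true
      forward : △-fold (Lplus-from L j (suc r)) v → Lplus L j v × χ v ≡ notⁿ j true
      forward (inj₁ (p , ∉tail)) with Lplus? (suc j) v
      ... | yes p′ = p , trans (¬-not (λ odd → ∉tail (from tail (p′ , trans odd (sym flips)))))
                               (not-involutive _)
      ... | no ¬p′ = p , Lplus-top-parity j p ¬p′
      forward (inj₂ (¬p , ∈tail)) = contradiction (Lplus-suc⇒Lplus j (proj₁ (to tail ∈tail))) ¬p
      backward : Lplus L j v × χ v ≡ notⁿ j true → △-fold (Lplus-from L j (suc r)) v
      backward (p , parity) = inj₁ (p , λ ∈tail → not-¬ parity (trans (proj₂ (to tail ∈tail)) flips))

    L≐△-fold-Lplus-from : L ≐ △-fold (Lplus-from L 0 k)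
    L≐△-fold-Lplus-from v = mk⇔
      (λ v∈L → from decomposition ((v , v∈L , ⊆-refl) , to ∈⇔χ≡true v∈L))
      (λ v∈△ → from ∈⇔χ≡true (proj₂ (to decomposition v∈△)))
      where
      decomposition = △-fold-Lplus-from 0 k ≤-refl v

-- Counting memberships in a symmetric difference

module _ {A : Set} where

  indicator : {P : Set} → Dec P → ℕ
  indicator (yes _) = 1
  indicator (no _)  = 0

  count : ∀ {k} {Ls : Vec (Language A) k} → All Decidable Ls → List A → ℕ
  count []         w = 0
  count (L? ∷ Ls?) w = indicator (L? w) + count Ls? w

  count≤k : ∀ {k} {Ls : Vec (Language A) k} (Ls? : All Decidable Ls) w → count Ls? w ≤ k
  count≤k []         w = z≤n
  count≤k (L? ∷ Ls?) w with L? w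
  ... | yes _ = s≤s (count≤k Ls? w)
  ... | no _  = m≤n⇒m≤1+n (count≤k Ls? w)

  △-fold⇒count>0 : ∀ {k} {Ls : Vec (Language A) k} (Ls? : All Decidable Ls) {w} →
                   △-fold Ls w → 0 < count Ls? w
  △-fold⇒count>0 (L? ∷ Ls?) {w} (inj₁ (p , _)) with L? w
  ... | yes _ = s≤s z≤n
  ... | no ¬p = contradiction p ¬p
  △-fold⇒count>0 (L? ∷ Ls?) {w} (inj₂ (_ , q)) =
    ≤-trans (△-fold⇒count>0 Ls? q) (m≤n+m _ (indicator (L? w)))

  count-mono : ∀ {k} {Ls : Vec (Language A) k} → All UpwardClosed Ls → (Ls? : All Decidable Ls) →
               ∀ {w w′} → w ⊑ w′ → count Ls? w ≤ count Ls? w′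
  count-mono []         []         _ = z≤n
  count-mono (up ∷ ups) (L? ∷ Ls?) {w} {w′} w⊑w′ with L? w | L? w′
  ... | yes _ | yes _ = s≤s (count-mono ups Ls? w⊑w′)
  ... | yes p | no ¬q = contradiction (up w⊑w′ p) ¬q
  ... | no _  | yes _ = m≤n⇒m≤1+n (count-mono ups Ls? w⊑w′)
  ... | no _  | no _  = count-mono ups Ls? w⊑w′

  count-≡⇒△-fold⇔ : ∀ {k} {Ls : Vec (Language A) k} → All UpwardClosed Ls → (Ls? : All Decidable Ls) →
                    ∀ {w w′} → w ⊑ w′ → count Ls? w ≡ count Ls? w′ → △-fold Ls w ⇔ △-fold Ls w′
  count-≡⇒△-fold⇔ []         []         _ _ = ⇔-id _
  count-≡⇒△-fold⇔ (up ∷ ups) (L? ∷ Ls?) {w} {w′} w⊑w′ same with L? w | L? w′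
  ... | yes p | yes q =
    △-cong (mk⇔ (λ _ → q) (λ _ → p)) (count-≡⇒△-fold⇔ ups Ls? w⊑w′ (suc-injective same))
  ... | no ¬p | no ¬q =
    △-cong (mk⇔ (⊥-elim ∘ ¬p) (⊥-elim ∘ ¬q)) (count-≡⇒△-fold⇔ ups Ls? w⊑w′ same)
  ... | yes p | no ¬q = contradiction (up w⊑w′ p) ¬q
  ... | no _  | yes _ = contradiction (≤-reflexive (sym same)) (≤⇒≯ (count-mono ups Ls? w⊑w′))

  module _ {k} {L : Language A} {Ls : Vec (Language A) k}
           (ups : All UpwardClosed Ls) (Ls? : All Decidable Ls) (L≐ : L ≐ △-fold Ls) where

    Arrow⇒count : ∀ m {w v} → Arrow L m w v → count Ls? w + m ≤ count Ls? v
    Arrow⇒count zero {w} w⊑v = ≤-trans (≤-reflexive (+-identityʳ (count Ls? w))) (count-mono ups Ls? w⊑v)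
    Arrow⇒count (suc m) {w} {v} (w₁ , w⊑w₁ , alt , r) = begin
      count Ls? w + suc m   ≡⟨ +-suc (count Ls? w) m ⟩
      suc (count Ls? w) + m ≤⟨ +-monoˡ-≤ m increases ⟩
      count Ls? w₁ + m      ≤⟨ Arrow⇒count m r ⟩
      count Ls? v           ∎
      where
      open ≤-Reasoning
      increases : count Ls? w < count Ls? w₁
      increases = ≤∧≢⇒< (count-mono ups Ls? w⊑w₁) λ same →
        ⇔⇒¬⇔¬ (⇔-sym (L≐ w₁) ⇔-∘ (count-≡⇒△-fold⇔ ups Ls? w⊑w₁ same ⇔-∘ L≐ w)) alt

    △-fold⇒m⁺< : m⁺ L < k
    △-fold⇒m⁺< m v (w , w∈L , r) = begin
      suc m           ≤⟨ +-monoˡ-≤ m (△-fold⇒count>0 Ls? (to (L≐ w) w∈L)) ⟩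
      count Ls? w + m ≤⟨ Arrow⇒count m r ⟩
      count Ls? v     ≤⟨ count≤k Ls? v ⟩
      k               ∎
      where open ≤-Reasoning

-- Chains as tagged words

module _ {A : Set} where

  tag≤? : ∀ i → Decidable {A = A × ℕ} ((_≤ i) ∘ proj₂)
  tag≤? i (_ , l) = l ≤? i

  -- A word x over A × ℕ encodes the chain layer 0 x ⊑ layer 1 x ⊑ ⋯, where the tag of
  -- a letter is the first layer it belongs to.
  layer : ℕ → List (A × ℕ) → List A
  layer i = map proj₁ ∘ filter (tag≤? i)

  layer-⊑-suc : ∀ i x → layer i x ⊑ layer (suc i) x
  layer-⊑-suc i x =
    map⁺ proj₁ (filter⁺ (tag≤? i) (tag≤? (suc i)) (λ { refl → m≤n⇒m≤1+n }) (⊆-refl {x = x}))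

  layer-mono : ∀ i {x′ x} → x′ ⊑ x → layer i x′ ⊑ layer i x
  layer-mono i x′⊑x = map⁺ proj₁ (filter⁺ (tag≤? i) (tag≤? i) (λ { refl l≤i → l≤i }) x′⊑x)

  length-layer : ∀ i x → length (layer i x) ≤ length x
  length-layer i x = ≤-trans (≤-reflexive (length-map proj₁ (filter (tag≤? i) x))) (length-filter (tag≤? i) x)

  untagged : List A → List (A × ℕ)
  untagged = map (_, 0)

  layer-untagged : ∀ i w → layer i (untagged w) ≡ w
  layer-untagged i []      = refl
  layer-untagged i (a ∷ w) = cong (a ∷_) (layer-untagged i w)

  -- Puts w below the chain coded by x: tags go up by one, except on the letters of w, which keep tag 0.
  refine : ∀ {w} (x : List (A × ℕ)) → w ⊑ layer 0 x → List (A × ℕ)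
  refine []                _          = []
  refine ((a , zero) ∷ x)  (_ ∷ʳ p)   = (a , 1) ∷ refine x p
  refine ((a , zero) ∷ x)  (refl ∷ p) = (a , 0) ∷ refine x p
  refine ((a , suc l) ∷ x) p          = (a , suc (suc l)) ∷ refine x p

  layer-zero-refine : ∀ {w} x (p : w ⊑ layer 0 x) → layer 0 (refine x p) ≡ w
  layer-zero-refine []                []         = refl
  layer-zero-refine ((a , zero) ∷ x)  (_ ∷ʳ p)   = layer-zero-refine x p
  layer-zero-refine ((a , zero) ∷ x)  (refl ∷ p) = cong (a ∷_) (layer-zero-refine x p)
  layer-zero-refine ((a , suc l) ∷ x) p          = layer-zero-refine x p

  layer-suc-refine : ∀ i {w} x (p : w ⊑ layer 0 x) → layer (suc i) (refine x p) ≡ layer i x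
  layer-suc-refine i []                []         = refl
  layer-suc-refine i ((a , zero) ∷ x)  (_ ∷ʳ p)   = cong (a ∷_) (layer-suc-refine i x p)
  layer-suc-refine i ((a , zero) ∷ x)  (refl ∷ p) = cong (a ∷_) (layer-suc-refine i x p)
  layer-suc-refine i ((a , suc l) ∷ x) p with does (suc l ≤? i)
  ... | true  = cong (a ∷_) (layer-suc-refine i x p)
  ... | false = layer-suc-refine i x p

module _ {A : Set} (L : Language A) where

  Alternating : ℕ → (ℕ → List A) → Set
  Alternating zero    ws = ⊤
  Alternating (suc m) ws = (L (ws 0) ⇔ (¬ L (ws 1))) × Alternating m (ws ∘ suc)

  Alternating⇒Arrow : ∀ m {ws} → (∀ i → ws i ⊑ ws (suc i)) → Alternating m ws → Arrow L m (ws 0) (ws m)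
  Alternating⇒Arrow zero    _    _            = ⊆-refl
  Alternating⇒Arrow (suc m) mono (alt , alts) = _ , mono 0 , alt , Alternating⇒Arrow m (mono ∘ suc) alts

  Alternating-transfer : ∀ m {ws ws′} → (∀ i → i ≤ m → L (ws i) ⇔ L (ws′ i)) →
                         Alternating m ws → Alternating m ws′
  Alternating-transfer zero    _     _            = tt
  Alternating-transfer (suc m) agree (alt , alts) =
    ¬-cong-⇔ (agree 1 (s≤s z≤n)) ⇔-∘ (alt ⇔-∘ ⇔-sym (agree 0 z≤n)) ,
    Alternating-transfer m (λ i i≤m → agree (suc i) (s≤s i≤m)) alts

  Arrow⇒tagged : ∀ m {w v} → Arrow L m w v →
                 ∃[ x ] (layer 0 x ≡ w × Alternating m (λ i → layer i x) × layer m x ⊑ v)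
  Arrow⇒tagged zero {w} {v} w⊑v =
    untagged w , layer-untagged 0 w , tt , subst (_⊑ v) (sym (layer-untagged 0 w)) w⊑v
  Arrow⇒tagged (suc m) {w} {v} (_ , w⊑w₁ , alt , r) with Arrow⇒tagged m r
  ... | x , refl , alts , top =
    refine x w⊑w₁ ,
    layer-zero-refine x w⊑w₁ ,
    Alternating-transfer (suc m) (λ i _ → subst (λ u → L (ws i) ⇔ L u) (ws≡ i) (⇔-id _)) (alt , alts) ,
    subst (_⊑ v) (sym (layer-suc-refine m x w⊑w₁)) top
    where
    ws : ℕ → List A
    ws zero    = w
    ws (suc i) = layer i x
    ws≡ : ∀ i → ws i ≡ layer i (refine x w⊑w₁)
    ws≡ zero    = sym (layer-zero-refine x w⊑w₁)
    ws≡ (suc i) = sym (layer-suc-refine i x w⊑w₁)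

module _ {A : Set} where
  open DFA

  restrict : ℕ → DFA {A} → DFA {A × ℕ}
  restrict i D = record
    { states = states D
    ; δ      = λ q (a , l) → if does (l ≤? i) then δ D q a else q
    ; q₀     = q₀ D
    ; final  = final D
    }

  run-restrict : ∀ i D q x → run (restrict i D) q x ≡ run D q (layer i x)
  run-restrict i D q []            = refl
  run-restrict i D q ((a , l) ∷ x) with does (l ≤? i)
  ... | true  = run-restrict i D (δ D q a) x
  ... | false = run-restrict i D q x

  -- Runs D on the layers 0, …, m simultaneously.
  layered : ℕ → DFA {A} → DFA {A × ℕ}
  layered zero    D = restrict 0 D
  layered (suc m) D = product (λ _ _ → false) (layered m D) (restrict (suc m) D)

  run-layered-suc : ∀ m D x →
    run (layered (suc m) D) (q₀ (layered (suc m) D)) x ≡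
    combine (run (layered m D) (q₀ (layered m D)) x) (run (restrict (suc m) D) (q₀ D) x)
  run-layered-suc m D = run-product (λ _ _ → false) (layered m D) (restrict (suc m) D) (q₀ (layered m D)) (q₀ D)

  layered-run-injective : ∀ m D x x′ →
    run (layered m D) (q₀ (layered m D)) x ≡ run (layered m D) (q₀ (layered m D)) x′ →
    ∀ i → i ≤ m → run D (q₀ D) (layer i x) ≡ run D (q₀ D) (layer i x′)
  layered-run-injective zero D x x′ same zero z≤n =
    trans (sym (run-restrict 0 D (q₀ D) x)) (trans same (run-restrict 0 D (q₀ D) x′))
  layered-run-injective (suc m) D x x′ same i i≤1+m
    with combine-injective _ _ _ _ (trans (sym (run-layered-suc m D x)) (trans same (run-layered-suc m D x′)))
  ... | same-below , same-top with m≤n⇒m<n∨m≡n i≤1+m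
  ...   | inj₁ i<1+m = layered-run-injective m D x x′ same-below i (≤-pred i<1+m)
  ...   | inj₂ refl  =
    trans (sym (run-restrict (suc m) D (q₀ D) x)) (trans same-top (run-restrict (suc m) D (q₀ D) x′))

  Lplus-HasBoundedBasis : ∀ {L : Language A} → Regular L → ∀ m → HasBoundedBasis (Lplus L m)
  Lplus-HasBoundedBasis {L} R@(D , _) m = states C , shrink
    where
    C = layered m D
    shrink : ∀ {v} → Lplus L m v → ∃[ u ] (u ⊑ v × length u ≤ states C × Lplus L m u)
    shrink (w , w∈L , r) with Arrow⇒tagged L m r
    ... | x , refl , alts , top with pump-down C (q₀ C) x
    ... | x′ , x′⊑x , short , same =
      layer m x′ ,
      ⊆-trans (layer-mono m x′⊑x) top ,
      ≤-trans (length-layer m x′) (<⇒≤ short) ,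
      (layer 0 x′ , to (agree 0 z≤n) w∈L ,
       Alternating⇒Arrow L m (λ i → layer-⊑-suc i x′) (Alternating-transfer L m agree alts))
      where
      agree : ∀ i → i ≤ m → L (layer i x) ⇔ L (layer i x′)
      agree i i≤m = Regular-run-≡⇒⇔ R (layered-run-injective m D x x′ (sym same) i i≤m)

module _ {A : Set} (_≟_ : DecidableEquality A) (letters : List A) (complete : ∀ a → a ∈ letters) where

  Lplus-InL½ : ∀ {L : Language A} → Regular L → ∀ m → InL½ (Lplus L m)
  Lplus-InL½ R m = HasBoundedBasis⇒InL½ letters complete
    (Lplus-UpwardClosed m) (Lplus? _≟_ (Regular⇒Decidable R) m) (Lplus-HasBoundedBasis R m)

  InL½[k]⇔Regular×m⁺< : ∀ {k} {L : Language A} → InL½[ k ] L ⇔ (Regular L × m⁺ L < k)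
  InL½[k]⇔Regular×m⁺< {k} {L} = mk⇔
    (λ L∈@(_ , Ls∈ , L≐) → InL½[k]⇒Regular _≟_ L∈ ,
       △-fold⇒m⁺< (All.map InL½⇒UpwardClosed Ls∈) (All.map (InL½⇒Decidable _≟_) Ls∈) L≐)
    (λ (R , bounded) → Lplus-from L 0 k , Lplus-from-InL½ R 0 k ,
       L≐△-fold-Lplus-from _≟_ (Regular⇒Decidable R) bounded)
    where
    Lplus-from-InL½ : Regular L → ∀ j r → All InL½ (Lplus-from L j r)
    Lplus-from-InL½ R j zero    = []
    Lplus-from-InL½ R j (suc r) = Lplus-InL½ R j ∷ Lplus-from-InL½ R (suc j) r

  InCoL½[k]⇒Decidable : ∀ {k} {L : Language A} → InCoL½[ k ] L → Decidable L
  InCoL½[k]⇒Decidable (M , M∈ , L⇔¬M) w =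
    map′ (from (L⇔¬M w)) (to (L⇔¬M w)) (¬? (Regular⇒Decidable (InL½[k]⇒Regular _≟_ M∈) w))

  InCoL½[k]⇔InL½[k]-∁ : ∀ {k} {L : Language A} → Decidable L → InCoL½[ k ] L ⇔ InL½[ k ] (∁ L)
  InCoL½[k]⇔InL½[k]-∁ L? = mk⇔
    (λ (M , M∈@(Ls , Ls∈ , M≐) , L⇔¬M) → Ls , Ls∈ , λ w →
       M≐ w ⇔-∘ ¬⇔ (Regular⇒Decidable (InL½[k]⇒Regular _≟_ M∈) w) (L⇔¬M w))
    (λ ∁L∈ → ∁ _ , ∁L∈ , λ w → mk⇔ (λ Lw ¬Lw → ¬Lw Lw) (decidable-stable (L? w)))
    where
    ¬⇔ : ∀ {P Q : Set} → Dec Q → P ⇔ (¬ Q) → (¬ P) ⇔ Q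
    ¬⇔ Q? P⇔¬Q = mk⇔ (λ ¬p → decidable-stable Q? (¬p ∘ from P⇔¬Q)) (λ q p → to P⇔¬Q p q)

  InCoL½[k]⇔Regular×m⁻< : ∀ {k} {L : Language A} → InCoL½[ k ] L ⇔ (Regular L × m⁻ L < k)
  InCoL½[k]⇔Regular×m⁻< = mk⇔ (λ L∈ → to (via (InCoL½[k]⇒Decidable L∈)) L∈)
                              (λ (R , bounded) → from (via (Regular⇒Decidable R)) (R , bounded))
    where
    via : ∀ {k} {L : Language A} → Decidable L → InCoL½[ k ] L ⇔ (Regular L × m⁻ L < k)
    via L? = ⇔-sym (Regular⇔Regular-∁ L? ×-⇔ m⁻<⇔m⁺∁< L?)
             ⇔-∘ (InL½[k]⇔Regular×m⁺< ⇔-∘ InCoL½[k]⇔InL½[k]-∁ L?)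

theorem4p2 : (n : ℕ) → 2 ≤ n → (L : Language (Fin n)) → (k : ℕ) → 1 ≤ k →
    (InL½[ k ] L ⇔ (Regular L × m⁺ L < k))
      × (InCoL½[ k ] L ⇔ (Regular L × m⁻ L < k))
theorem4p2 n _ L k _ =
  InL½[k]⇔Regular×m⁺< Fin._≟_ (allFin n) ∈-allFin ,
  InCoL½[k]⇔Regular×m⁻< Fin._≟_ (allFin n) ∈-allFin
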